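{- Let $r,c,t$ be positive integers. The set of $T\in SSYT(r,c,t)$ unmatched by $M$ is in bijection with: (1) if $r+t-1$ is odd, the set of semistandard domino tableaux of rectangular shape $r\times c$ with all labels odd integers in $[0,r+t-1]$; (2) if $r+t-1$ is even, the set of semistandard domino tableaux of rectangular shape $r\times c$ whose dominos are labeled by odd integers in $[0,r+t-2]$, where in addition monominos (single cells) labeled $r+t-1$ are allowed in the last row.
   Context: $SSYT(r,c,t)$ is the set of $r\times c$ arrays $T$ (rows $1,\dots,r$ top to bottom) with entries in $\{0,\dots,r+t-1\}$, weakly increasing along rows and strictly increasing down columns. For a row $R$ and value $i$, $(R,i)$ satisfies (1) if $i$ is odd, occurs in row $R$, and the number of occurrences of $i$ in row $R$ without $i-1$ immediately above (vacuous for row $1$) is odd; $(R,i)$ satisfies (2) if $i$ is even, $i<r+t-1$, $i$ occurs in row $R$, the rightmost occurrence of $i$ in row $R$ does not have $i+1$ immediately below it (vacuous for $R=r$), and the number of occurrences of $i+1$ in row $R$ without $i$ immediately above is even (possibly zero). $T$ is unmatched by $M$ if no $(R,i)$ satisfies (1) or (2). A semistandard domino tableau of shape $r\times c$ is a tiling of the $r\times c$ rectangle by dominos ($1\times2$ or $2\times1$ rectangles; in case (2) also the allowed monominos), each tile labeled by an integer, such that, assigning to each cell the label of its tile, labels weakly increase from left to right along rows and strictly increase from top to bottom down columns, comparisons being made between cells in distinct tiles. -}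

module Defs where

open import Data.Nat using (ℕ; zero; suc; _+_; _∸_; _≤_; _<_; _%_)
open import Data.Nat.Properties using (_≟_)
open import Data.Fin using (Fin; toℕ)
open import Data.Vec using (Vec; []; _∷_; lookup)
open import Data.List using (List; length; filter; allFin)
open import Data.Maybe using (Maybe; just; nothing)
import Data.Maybe.Properties as MaybeP
open import Data.Product using (Σ; ∃; ∃-syntax; _×_; _,_)
open import Data.Empty using (⊥)
open import Relation.Nullary using (¬_)
open import Relation.Nullary.Decidable using (_×-dec_; ¬?)
open import Relation.Binary.PropositionalEquality using (_≡_)

-- r × c arrays, stored as a vector of r rows (row 1 = index 0 = top).

Array : Set → ℕ → ℕ → Set
Array A r c = Vec (Vec A c) r

at : ∀ {A r c} → Array A r c → Fin r → Fin c → A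
at T i j = lookup (lookup T i) j

entry? : ∀ {A r c} → Array A r c → ℕ → Fin c → Maybe A
entry? []         _       _ = nothing
entry? (row ∷ _)  zero    j = just (lookup row j)
entry? (_ ∷ rows) (suc k) j = entry? rows k j

above : ∀ {A r c} → Array A r c → Fin r → Fin c → Maybe A
above T R j with toℕ R
... | zero  = nothing
... | suc k = entry? T k j

below : ∀ {A r c} → Array A r c → Fin r → Fin c → Maybe A
below T R j = entry? T (suc (toℕ R)) j

IsSSYT : (r c t : ℕ) → Array ℕ r c → Set
IsSSYT r c t T =
  (∀ i j → at T i j < r + t)
  × (∀ i j j' → toℕ j < toℕ j' → at T i j ≤ at T i j')
  × (∀ i i' j → toℕ i < toℕ i' → at T i j < at T i' j)

Odd Even : ℕ → Set
Odd n = n % 2 ≡ 1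
Even n = n % 2 ≡ 0

-- number of occurrences of v in row R that do NOT have w immediately above
-- (for the top row nothing is above, so every occurrence counts)
countNoAbove : ∀ {r c} → Array ℕ r c → Fin r → (v w : ℕ) → ℕ
countNoAbove {c = c} T R v w =
  length (filter (λ j → (at T R j ≟ v) ×-dec ¬? (MaybeP.≡-dec _≟_ (above T R j) (just w)))
                 (allFin c))

Cond1 : ∀ {r c} → Array ℕ r c → Fin r → ℕ → Set
Cond1 T R i =
  Odd i × (∃[ j ] at T R j ≡ i) × Odd (countNoAbove T R i (i ∸ 1))

-- condition (2) for (R,i); the rightmost occurrence of i in row R is the
-- column j with entry i and no entry i strictly to its right.
Cond2 : ∀ {r c} → (t : ℕ) → Array ℕ r c → Fin r → ℕ → Set
Cond2 {r} t T R i =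
  Even i × i < r + t ∸ 1
  × (∃[ j ] (at T R j ≡ i
             × (∀ j' → toℕ j < toℕ j' → ¬ (at T R j' ≡ i))
             × ¬ (below T R j ≡ just (suc i))))
  × Even (countNoAbove T R (suc i) i)

Unmatched : ∀ {r c} → (t : ℕ) → Array ℕ r c → Set
Unmatched t T = ∀ R i → ¬ Cond1 T R i × ¬ Cond2 t T R i

UnmatchedSSYT : (r c t : ℕ) → Array ℕ r c → Set
UnmatchedSSYT r c t T = IsSSYT r c t T × Unmatched t T

-- Domino tilings of the r × c rectangle.  A tiling is encoded by recording,
-- for each cell, which part of which tile it is; this encoding is in
-- one-to-one correspondence with tilings.

data Piece : Set where
  hl : Piece   -- left cell of a horizontal domino (partner to the right)
  hr : Piece   -- right cell of a horizontal domino (partner to the left)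
  vt : Piece   -- top cell of a vertical domino (partner below)
  vb : Piece   -- bottom cell of a vertical domino (partner above)
  mono : Piece

IsTiling : ∀ {r c} → Array Piece r c → Set
IsTiling {r} {c} P =
  (∀ i j → at P i j ≡ hl → ∃[ j' ] (toℕ j' ≡ suc (toℕ j) × at P i j' ≡ hr))
  × (∀ i j → at P i j ≡ hr → ∃[ j' ] (suc (toℕ j') ≡ toℕ j × at P i j' ≡ hl))
  × (∀ i j → at P i j ≡ vt → ∃[ i' ] (toℕ i' ≡ suc (toℕ i) × at P i' j ≡ vb))
  × (∀ i j → at P i j ≡ vb → ∃[ i' ] (suc (toℕ i') ≡ toℕ i × at P i' j ≡ vt))

SameTileRow : ∀ {r c} → Array Piece r c → Fin r → Fin c → Fin c → Set
SameTileRow P i j j' = at P i j ≡ hl × toℕ j' ≡ suc (toℕ j)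

SameTileCol : ∀ {r c} → Array Piece r c → Fin r → Fin r → Fin c → Set
SameTileCol P i i' j = at P i j ≡ vt × toℕ i' ≡ suc (toℕ i)

-- A semistandard domino(/monomino) tableau of shape r × c:
-- a tiling P together with the label L of each cell (= label of its tile).
-- DomLabel says which labels dominos may carry; MonoOK i ℓ says a
-- monomino in row i may carry label ℓ (⊥ = no monominos).
IsSSDT : (r c : ℕ) → (DomLabel : ℕ → Set) → (MonoOK : Fin r → ℕ → Set)
       → Array Piece r c × Array ℕ r c → Set
IsSSDT r c DomLabel MonoOK (P , L) =
  IsTiling P
  × (∀ i j j' → SameTileRow P i j j' → at L i j ≡ at L i j')
  × (∀ i i' j → SameTileCol P i i' j → at L i j ≡ at L i' j)
  × (∀ i j → ¬ (at P i j ≡ mono) → DomLabel (at L i j))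
  × (∀ i j → at P i j ≡ mono → MonoOK i (at L i j))
  × (∀ i j j' → toℕ j < toℕ j' → ¬ SameTileRow P i j j' → at L i j ≤ at L i j')
  × (∀ i i' j → toℕ i < toℕ i' → ¬ SameTileCol P i i' j → at L i j < at L i' j)

NoMono : ∀ {r} → Fin r → ℕ → Set
NoMono _ _ = ⊥

-- A bijection between the subsets {a | P a} ⊆ A and {b | Q b} ⊆ B
-- (elements compared by their underlying data).

record SubsetBijection {A B : Set} (P : A → Set) (Q : B → Set) : Set where
  field
    to      : (a : A) → P a → B
    to-ok   : ∀ a (p : P a) → Q (to a p)
    from    : (b : B) → Q b → A
    from-ok : ∀ b (q : Q b) → P (from b q)
    from-to : ∀ a (p : P a) → from (to a p) (to-ok a p) ≡ a
    to-from : ∀ b (q : Q b) → to (from b q) (from-ok b q) ≡ b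

-- An even entry x < N = r + t − 1 of an unmatched T has x + 1 directly below it: otherwise the
-- rightmost x of its row satisfies (2), or x + 1 satisfies (1). Such pairs become vertical
-- dominos labelled x + 1, and an entry N (N even) can only occur in the last row, where it
-- becomes a monomino. An odd x with x − 1 above it is the bottom of a vertical domino; the
-- remaining ("free") occurrences of an odd x in a row form an interval, of even length since
-- (1) fails, and are paired from left to right into horizontal dominos labelled x.
-- Conversely, lowering the label of every top cell of a vertical domino by one recovers T, and
-- the number of free occurrences of x left of a cell is odd exactly when the cell to its left is
-- the left half of a horizontal domino labelled x; this shows that the first map inverts the
-- second and that the result is unmatched.

module Submission where

open import Defs
open import Data.Bool using (Bool; true; false; _∨_; if_then_else_)
open import Data.Empty using (⊥; ⊥-elim)
open import Data.Fin using (Fin; toℕ; fromℕ<)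
open import Data.Fin.Properties using (toℕ-injective; toℕ<n; toℕ-fromℕ<; fromℕ<-toℕ; toℕ-inject₁)
open import Data.List using (length; filter) renaming (tabulate to tabulateList)
import Data.List as List
import Data.Fin as Fin
open import Data.Maybe using (Maybe; just)
import Data.Maybe.Properties as Maybe
open import Data.Nat using (ℕ; zero; suc; _+_; _∸_; _≤_; _<_; _%_; z≤n; s≤s; s≤s⁻¹; _<?_)
open import Data.Nat.Properties
open import Data.Product using (Σ-syntax; ∃-syntax; _×_; _,_; proj₁; proj₂)
open import Data.Sum using (_⊎_; inj₁; inj₂)
open import Data.Vec using (_∷_; lookup; tabulate)
open import Data.Vec.Properties using (lookup∘tabulate; tabulate∘lookup; tabulate-cong)
open import Function using (_∘_; id)
open import Function.Bundles using (_⇔_; mk⇔; Equivalence)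
open import Relation.Nullary using (¬_; Dec; yes; no; does; contradiction)
open import Relation.Nullary.Decidable using (dec-true; dec-false; _×-dec_; ¬?; map′)
open import Relation.Binary.PropositionalEquality

odd? : ∀ n → Dec (Odd n)
odd? n = n % 2 ≟ 1

even⊎odd : ∀ n → Even n ⊎ Odd n
even⊎odd zero          = inj₁ refl
even⊎odd (suc zero)    = inj₂ refl
even⊎odd (suc (suc n)) = even⊎odd n

even⇒¬odd : ∀ n → Even n → ¬ Odd n
even⇒¬odd _ e o = 0≢1+n (trans (sym e) o)

¬odd⇒even : ∀ n → ¬ Odd n → Even n
¬odd⇒even n ¬o with even⊎odd n
... | inj₁ e = e
... | inj₂ o = ⊥-elim (¬o o)

even⇒odd-suc : ∀ n → Even n → Odd (suc n)
even⇒odd-suc zero          _ = refl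
even⇒odd-suc (suc (suc n)) e = even⇒odd-suc n e

odd⇒even-suc : ∀ n → Odd n → Even (suc n)
odd⇒even-suc (suc zero)    _ = refl
odd⇒even-suc (suc (suc n)) o = odd⇒even-suc n o

odd-suc⇒even : ∀ n → Odd (suc n) → Even n
odd-suc⇒even n o with even⊎odd n
... | inj₁ e  = e
... | inj₂ o' = ⊥-elim (even⇒¬odd (suc n) (odd⇒even-suc n o') o)

odd⇒0< : ∀ n → Odd n → 0 < n
odd⇒0< (suc n) _ = s≤s z≤n

odd⇒suc-pred : ∀ n → Odd n → suc (n ∸ 1) ≡ n
odd⇒suc-pred (suc n) _ = refl

odd⇒even-pred : ∀ n → Odd n → Even (n ∸ 1)
odd⇒even-pred (suc n) o = odd-suc⇒even n o

odd<odd⇒2+≤ : ∀ {m n} → Odd m → Odd n → m < n → 2 + m ≤ n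
odd<odd⇒2+≤ {m} om on m<n with m≤n⇒m<n∨m≡n m<n
... | inj₁ 1+m<n = 1+m<n
... | inj₂ refl  = ⊥-elim (even⇒¬odd (suc m) (odd⇒even-suc m om) on)

pred< : ∀ {n} → 0 < n → n ∸ 1 < n
pred< 0<n = ∸-monoʳ-< {o = 0} (s≤s z≤n) 0<n

false≢true : ∀ {b} → b ≡ false → b ≢ true
false≢true refl ()

dec-true⁻¹ : ∀ {A : Set} (a? : Dec A) → does a? ≡ true → A
dec-true⁻¹ (yes a) _ = a

count : (ℕ → Bool) → ℕ → ℕ
count h zero    = 0
count h (suc k) = if h k then suc (count h k) else count h k

count-true : ∀ h k → h k ≡ true → count h (suc k) ≡ suc (count h k)
count-true h k hk rewrite hk = refl

count-false : ∀ h k → h k ≡ false → count h (suc k) ≡ count h k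
count-false h k hk rewrite hk = refl

count-differs⇒∃ : ∀ h {k m} → k ≤ m → count h k ≢ count h m → ∃[ n ] (k ≤ n × n < m × h n ≡ true)
count-differs⇒∃ h {m = zero} z≤n ne = ⊥-elim (ne refl)
count-differs⇒∃ h {k} {suc m} k≤1+m ne with k ≟ suc m
... | yes refl = ⊥-elim (ne refl)
... | no k≢1+m with h m in hm
...   | true  = m , ≤-pred (≤∧≢⇒< k≤1+m k≢1+m) , ≤-refl , hm
...   | false with count-differs⇒∃ h (≤-pred (≤∧≢⇒< k≤1+m k≢1+m)) ne
...     | n , k≤n , n<m , hn = n , k≤n , m≤n⇒m≤1+n n<m , hn

count-pos⇒∃ : ∀ h {m} → 0 < count h m → ∃[ n ] (n < m × h n ≡ true)
count-pos⇒∃ h {m} pos with count-differs⇒∃ h {0} {m} z≤n (λ e → <⇒≢ pos e)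
... | n , _ , n<m , hn = n , n<m , hn

indicator : Bool → ℕ
indicator b = if b then 1 else 0

count-suc-shift : ∀ h n → count h (suc n) ≡ indicator (h 0) + count (h ∘ suc) n
count-suc-shift h zero with h 0
... | true  = refl
... | false = refl
count-suc-shift h (suc n) with h (suc n) | count-suc-shift h n
... | true  | ih = trans (cong suc ih) (sym (+-suc (indicator (h 0)) _))
... | false | ih = ih

length-filter-∷ : ∀ {A : Set} {P : A → Set} (P? : ∀ a → Dec (P a)) x xs
  → length (filter P? (x List.∷ xs)) ≡ indicator (does (P? x)) + length (filter P? xs)
length-filter-∷ P? x xs with does (P? x)
... | true  = refl
... | false = refl

length-filter-tabulate : ∀ {A : Set} {P : A → Set} (P? : ∀ a → Dec (P a)) n (g : Fin n → A) (h : ℕ → Bool)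
  → (∀ j → does (P? (g j)) ≡ h (toℕ j)) → length (filter P? (tabulateList g)) ≡ count h n
length-filter-tabulate P? zero    g h _  = refl
length-filter-tabulate P? (suc n) g h eq = begin
  length (filter P? (tabulateList g))
    ≡⟨ length-filter-∷ P? (g Fin.zero) _ ⟩
  indicator (does (P? (g Fin.zero))) + length (filter P? (tabulateList (g ∘ Fin.suc)))
    ≡⟨ cong₂ _+_ (cong indicator (eq Fin.zero)) (length-filter-tabulate P? n (g ∘ Fin.suc) (h ∘ suc) (eq ∘ Fin.suc)) ⟩
  indicator (h 0) + count (h ∘ suc) n
    ≡⟨ count-suc-shift h n ⟨
  count h (suc n) ∎
  where open ≡-Reasoning

-- A Fin-indexed predicate read off on ℕ; false beyond the end.
onℕ : ∀ {n} → (Fin n → Bool) → ℕ → Bool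
onℕ {n} f k with k <? n
... | yes k<n = f (fromℕ< k<n)
... | no _    = false

onℕ-toℕ : ∀ {n} (f : Fin n → Bool) j → onℕ f (toℕ j) ≡ f j
onℕ-toℕ {n} f j with toℕ j <? n
... | yes j<n = cong f (fromℕ<-toℕ j j<n)
... | no j≮n  = ⊥-elim (j≮n (toℕ<n j))

onℕ-fromℕ< : ∀ {n} (f : Fin n → Bool) {k} (k<n : k < n) → onℕ f k ≡ f (fromℕ< k<n)
onℕ-fromℕ< f k<n = trans (cong (onℕ f) (sym (toℕ-fromℕ< k<n))) (onℕ-toℕ f _)

onℕ-true : ∀ {n} (f : Fin n → Bool) k → onℕ f k ≡ true → ∃[ j ] (toℕ j ≡ k × f j ≡ true)
onℕ-true {n} f k e with k <? n
... | yes k<n = fromℕ< k<n , toℕ-fromℕ< k<n , e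

successor : ∀ {n} (j : Fin n) → suc (toℕ j) < n → Σ[ j' ∈ Fin n ] toℕ j' ≡ suc (toℕ j)
successor j j+1<n = fromℕ< j+1<n , toℕ-fromℕ< j+1<n

predecessor : ∀ {n} (j : Fin n) → 0 < toℕ j → Σ[ j' ∈ Fin n ] suc (toℕ j') ≡ toℕ j
predecessor (Fin.suc j) _ = Fin.inject₁ j , cong suc (toℕ-inject₁ j)

rightmostℕ : ∀ (h : ℕ → Bool) n {k} → k < n → h k ≡ true
  → ∃[ m ] (k ≤ m × m < n × h m ≡ true × ∀ m' → m < m' → m' < n → h m' ≡ false)
rightmostℕ h (suc n) {k} k<1+n hk with h n in hn
... | true  = n , ≤-pred k<1+n , ≤-refl , hn , λ m' n<m' m'<1+n → ⊥-elim (<⇒≱ n<m' (≤-pred m'<1+n))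
... | false with rightmostℕ h n (≤∧≢⇒< (≤-pred k<1+n) λ { refl → contradiction (trans (sym hk) hn) λ () }) hk
...   | m , k≤m , m<n , hm , last = m , k≤m , m≤n⇒m≤1+n m<n , hm , beyond
  where
    beyond : ∀ m' → m < m' → m' < suc n → h m' ≡ false
    beyond m' m<m' m'<1+n with m≤n⇒m<n∨m≡n (≤-pred m'<1+n)
    ... | inj₁ m'<n = last m' m<m' m'<n
    ... | inj₂ refl = hn

rightmost : ∀ {n} {P : Fin n → Set} (P? : ∀ j → Dec (P j)) j → P j
  → ∃[ j* ] (toℕ j ≤ toℕ j* × P j* × ∀ j' → toℕ j* < toℕ j' → ¬ P j')
rightmost {n} P? j pj
  with rightmostℕ (onℕ (does ∘ P?)) n (toℕ<n j) (trans (onℕ-toℕ _ j) (dec-true (P? j) pj))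
... | m , j≤m , _ , hm , last with onℕ-true (does ∘ P?) m hm
...   | j* , refl , pj* = j* , j≤m , dec-true⁻¹ (P? j*) pj* , beyond
  where
    beyond : ∀ j' → toℕ j* < toℕ j' → ¬ _
    beyond j' j*<j' pj'
      with trans (sym (dec-true (P? j') pj')) (trans (sym (onℕ-toℕ _ j')) (last (toℕ j') j*<j' (toℕ<n j')))
    ... | ()

tabulate₂ : ∀ {A : Set} {r c} → (Fin r → Fin c → A) → Array A r c
tabulate₂ f = tabulate (tabulate ∘ f)

at-tabulate₂ : ∀ {A : Set} {r c} (f : Fin r → Fin c → A) i j → at (tabulate₂ f) i j ≡ f i j
at-tabulate₂ f i j rewrite lookup∘tabulate (tabulate ∘ f) i = lookup∘tabulate (f i) j

tabulate₂-at : ∀ {A : Set} {r c} (f : Fin r → Fin c → A) (X : Array A r c)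
  → (∀ i j → f i j ≡ at X i j) → tabulate₂ f ≡ X
tabulate₂-at f X eq = trans (tabulate-cong λ i → trans (tabulate-cong (eq i)) (tabulate∘lookup (lookup X i)))
                            (tabulate∘lookup X)

entry?-toℕ : ∀ {A : Set} {r c} (T : Array A r c) i j → entry? T (toℕ i) j ≡ just (at T i j)
entry?-toℕ (_ ∷ _) Fin.zero    j = refl
entry?-toℕ (_ ∷ T) (Fin.suc i) j = entry?-toℕ T i j

entry?≡just : ∀ {A : Set} {r c} (T : Array A r c) k j {v}
  → entry? T k j ≡ just v → ∃[ i ] (toℕ i ≡ k × at T i j ≡ v)
entry?≡just (_ ∷ _) zero    j refl = Fin.zero , refl , refl
entry?≡just (_ ∷ T) (suc k) j e with entry?≡just T k j e
... | i , refl , v = Fin.suc i , refl , v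

above-of : ∀ {A : Set} {r c} (T : Array A r c) {i i'} j → suc (toℕ i') ≡ toℕ i → above T i j ≡ just (at T i' j)
above-of T {i} {i'} j i'+1≡i with toℕ i | i'+1≡i
... | .(suc (toℕ i')) | refl = entry?-toℕ T i' j

above≡just : ∀ {A : Set} {r c} (T : Array A r c) i j {v}
  → above T i j ≡ just v → ∃[ i' ] (suc (toℕ i') ≡ toℕ i × at T i' j ≡ v)
above≡just T i j e with toℕ i
... | suc k with entry?≡just T k j e
...   | i' , refl , v = i' , refl , v

below-of : ∀ {A : Set} {r c} (T : Array A r c) {i i'} j → toℕ i' ≡ suc (toℕ i) → below T i j ≡ just (at T i' j)
below-of T {i' = i'} j i'≡i+1 = subst (λ k → entry? T k j ≡ just (at T i' j)) i'≡i+1 (entry?-toℕ T i' j)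

below≡just : ∀ {A : Set} {r c} (T : Array A r c) i j {v}
  → below T i j ≡ just v → ∃[ i' ] (toℕ i' ≡ suc (toℕ i) × at T i' j ≡ v)
below≡just T i j = entry?≡just T (suc (toℕ i)) j

pieceCode : Piece → ℕ
pieceCode hl   = 0
pieceCode hr   = 1
pieceCode vt   = 2
pieceCode vb   = 3
pieceCode mono = 4

pieceDecode : ℕ → Piece
pieceDecode 0 = hl
pieceDecode 1 = hr
pieceDecode 2 = vt
pieceDecode 3 = vb
pieceDecode _ = mono

pieceDecode-pieceCode : ∀ p → pieceDecode (pieceCode p) ≡ p
pieceDecode-pieceCode hl   = refl
pieceDecode-pieceCode hr   = refl
pieceDecode-pieceCode vt   = refl
pieceDecode-pieceCode vb   = refl
pieceDecode-pieceCode mono = refl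

_≟ₚ_ : (p q : Piece) → Dec (p ≡ q)
p ≟ₚ q = map′ code-injective (cong pieceCode) (pieceCode p ≟ pieceCode q)
  where
    code-injective : pieceCode p ≡ pieceCode q → p ≡ q
    code-injective e = trans (sym (pieceDecode-pieceCode p)) (trans (cong pieceDecode e) (pieceDecode-pieceCode q))

sameTileRow? : ∀ {r c} (P : Array Piece r c) i j j' → Dec (SameTileRow P i j j')
sameTileRow? P i j j' = (at P i j ≟ₚ hl) ×-dec (toℕ j' ≟ suc (toℕ j))

sameTileCol? : ∀ {r c} (P : Array Piece r c) i i' j → Dec (SameTileCol P i i' j)
sameTileCol? P i i' j = (at P i j ≟ₚ vt) ×-dec (toℕ i' ≟ suc (toℕ i))

raise : Piece → ℕ → ℕ
raise vt x = suc x
raise _  x = x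

lower : Piece → ℕ → ℕ
lower vt ℓ = ℓ ∸ 1
lower _  ℓ = ℓ

lower-raise : ∀ p x → lower p (raise p x) ≡ x
lower-raise hl   x = refl
lower-raise hr   x = refl
lower-raise vt   x = refl
lower-raise vb   x = refl
lower-raise mono x = refl

raise-lower : ∀ p ℓ → (p ≡ vt → Odd ℓ) → raise p (lower p ℓ) ≡ ℓ
raise-lower hl   ℓ _   = refl
raise-lower hr   ℓ _   = refl
raise-lower vt   ℓ odd = odd⇒suc-pred ℓ (odd refl)
raise-lower vb   ℓ _   = refl
raise-lower mono ℓ _   = refl

lower-≢vt : ∀ p ℓ → p ≢ vt → lower p ℓ ≡ ℓ
lower-≢vt hl   ℓ _   = refl
lower-≢vt hr   ℓ _   = refl
lower-≢vt vt   ℓ ≢vt = ⊥-elim (≢vt refl)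
lower-≢vt vb   ℓ _   = refl
lower-≢vt mono ℓ _   = refl

lower-≤ : ∀ p ℓ → lower p ℓ ≤ ℓ
lower-≤ hl   ℓ = ≤-refl
lower-≤ hr   ℓ = ≤-refl
lower-≤ vt   ℓ = m∸n≤m ℓ 1
lower-≤ vb   ℓ = ≤-refl
lower-≤ mono ℓ = ≤-refl

module DominoRow {c} (h : Fin c → Bool) (p : Fin c → Piece)
  (paired : ∀ j → h j ≡ true
    → (p j ≡ hl × ∃[ j' ] (toℕ j' ≡ suc (toℕ j) × h j' ≡ true × p j' ≡ hr))
    ⊎ (p j ≡ hr × ∃[ j' ] (suc (toℕ j') ≡ toℕ j × h j' ≡ true × p j' ≡ hl)))
  where

  OpenAt : ℕ → Set
  OpenAt k = ∃[ j ] (suc (toℕ j) ≡ k × h j ≡ true × p j ≡ hl)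

  private
    closed-by : ∀ {k j} → toℕ j ≡ k → OpenAt k → h j ≡ true × p j ≡ hr
    closed-by {j = j} j≡k (j₀ , j₀+1≡k , hj₀ , hl₀) with paired j₀ hj₀
    ... | inj₁ (_ , j' , j'≡j₀+1 , hj' , hr') with toℕ-injective (trans j'≡j₀+1 (trans j₀+1≡k (sym j≡k)))
    ...   | refl = hj' , hr'
    closed-by _ (_ , _ , _ , hl₀) | inj₂ (hr₀ , _) = contradiction (trans (sym hl₀) hr₀) λ ()

    open-at : ∀ {k j} → toℕ j ≡ k → OpenAt (suc k) → h j ≡ true × p j ≡ hl
    open-at {j = j} j≡k (j₁ , j₁+1≡k+1 , hj₁ , hl₁) with toℕ-injective (trans (suc-injective j₁+1≡k+1) (sym j≡k))
    ... | refl = hj₁ , hl₁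

  odd-count⇔open : ∀ k → k ≤ c → (Odd (count (onℕ h) k) → OpenAt k) × (OpenAt k → Odd (count (onℕ h) k))
  odd-count⇔open zero    _   = (λ ()) , λ { (_ , () , _) }
  odd-count⇔open (suc k) k<c with odd-count⇔open k (<⇒≤ k<c) | onℕ-fromℕ< h k<c | toℕ-fromℕ< k<c
  ... | odd⇒open , open⇒odd | onℕ≡ | j≡k with h (fromℕ< k<c) in hj | paired (fromℕ< k<c)
  ...   | false | _ rewrite count-false (onℕ h) k onℕ≡ =
            (λ o → ⊥-elim (false≢true hj (proj₁ (closed-by j≡k (odd⇒open o)))))
          , (λ op → ⊥-elim (false≢true hj (proj₁ (open-at j≡k op))))
  ...   | true | pairing rewrite count-true (onℕ h) k onℕ≡ with pairing refl
  ...     | inj₁ (hl-j , _) =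
              (λ _ → fromℕ< k<c , cong suc j≡k , hj , hl-j)
            , (λ _ → even⇒odd-suc (count (onℕ h) k) (¬odd⇒even (count (onℕ h) k) λ o →
                       contradiction (trans (sym hl-j) (proj₂ (closed-by j≡k (odd⇒open o)))) λ ()))
  ...     | inj₂ (hr-j , j' , j'+1≡j , hj' , hl') =
              (λ o → contradiction o (even⇒¬odd (suc (count (onℕ h) k))
                                        (odd⇒even-suc (count (onℕ h) k) (open⇒odd (j' , trans j'+1≡j j≡k , hj' , hl')))))
            , (λ op → contradiction (trans (sym hr-j) (proj₂ (open-at j≡k op))) λ ())

  even-count : Even (count (onℕ h) c)
  even-count = ¬odd⇒even (count (onℕ h) c) λ o → no-open-at-end (proj₁ (odd-count⇔open c ≤-refl) o)
    where
      no-open-at-end : ¬ OpenAt c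
      no-open-at-end (j , j+1≡c , hj , hl-j) with paired j hj
      ... | inj₁ (_ , j' , j'≡j+1 , _) = <-irrefl (trans j'≡j+1 j+1≡c) (toℕ<n j')
      ... | inj₂ (hr-j , _) = contradiction (trans (sym hl-j) hr-j) λ ()

  even-count-before-hl : ∀ j → h j ≡ true → p j ≡ hl → Even (count (onℕ h) (toℕ j))
  even-count-before-hl j hj hl-j = ¬odd⇒even (count (onℕ h) (toℕ j)) λ o →
    contradiction (trans (sym hl-j) (proj₂ (closed-by refl (proj₁ (odd-count⇔open (toℕ j) (<⇒≤ (toℕ<n j))) o)))) λ ()

  odd-count-before-hr : ∀ j → h j ≡ true → p j ≡ hr → Odd (count (onℕ h) (toℕ j))
  odd-count-before-hr j hj hr-j with paired j hj
  ... | inj₁ (hl-j , _) = contradiction (trans (sym hl-j) hr-j) λ ()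
  ... | inj₂ (_ , open-j) = proj₂ (odd-count⇔open (toℕ j) (<⇒≤ (toℕ<n j))) open-j

_≟ₘ_ : (a b : Maybe ℕ) → Dec (a ≡ b)
_≟ₘ_ = Maybe.≡-dec _≟_

-- The piece of a cell with entry x, entry a above it and n free occurrences of x to its left;
-- N = r + t − 1 is the largest entry.
classify : (N x : ℕ) → Maybe ℕ → ℕ → Piece
classify N x a n =
  if does (odd? x)
  then (if does (a ≟ₘ just (x ∸ 1)) then vb else if does (odd? n) then hr else hl)
  else (if does (x ≟ N) then mono else vt)

data Classification (N x : ℕ) (a : Maybe ℕ) (n : ℕ) : Piece → Set where
  bottom : Odd x → a ≡ just (x ∸ 1) → Classification N x a n vb
  left   : Odd x → a ≢ just (x ∸ 1) → Even n → Classification N x a n hl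
  right  : Odd x → a ≢ just (x ∸ 1) → Odd n → Classification N x a n hr
  top    : Even x → x ≢ N → Classification N x a n vt
  single : Even x → x ≡ N → Classification N x a n mono

classification⇒classify : ∀ {N x a n p} → Classification N x a n p → classify N x a n ≡ p
classification⇒classify {N} {x} {a} (bottom ox a≡)
  rewrite dec-true (odd? x) ox | dec-true (a ≟ₘ just (x ∸ 1)) a≡ = refl
classification⇒classify {N} {x} {a} {n} (left ox a≢ en)
  rewrite dec-true (odd? x) ox | dec-false (a ≟ₘ just (x ∸ 1)) a≢ | dec-false (odd? n) (even⇒¬odd n en) = refl
classification⇒classify {N} {x} {a} {n} (right ox a≢ on)
  rewrite dec-true (odd? x) ox | dec-false (a ≟ₘ just (x ∸ 1)) a≢ | dec-true (odd? n) on = refl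
classification⇒classify {N} {x} (top ex x≢N)
  rewrite dec-false (odd? x) (even⇒¬odd x ex) | dec-false (x ≟ N) x≢N = refl
classification⇒classify {N} {x} (single ex x≡N)
  rewrite dec-false (odd? x) (even⇒¬odd x ex) | dec-true (x ≟ N) x≡N = refl

classify-cases : ∀ N x a n → ∃[ p ] Classification N x a n p
classify-cases N x a n with odd? x
... | no ¬ox with x ≟ N
...   | yes x≡N = mono , single (¬odd⇒even x ¬ox) x≡N
...   | no x≢N  = vt , top (¬odd⇒even x ¬ox) x≢N
classify-cases N x a n | yes ox with a ≟ₘ just (x ∸ 1)
...   | yes a≡ = vb , bottom ox a≡
...   | no a≢ with odd? n
...     | yes on  = hr , right ox a≢ on
...     | no ¬on = hl , left ox a≢ (¬odd⇒even n ¬on)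

classification : ∀ N x a n → Classification N x a n (classify N x a n)
classification N x a n with classify-cases N x a n
... | _ , v = subst (Classification N x a n) (sym (classification⇒classify v)) v

-- The label of the tile containing an entry x.
roundUp : ℕ → ℕ → ℕ
roundUp N x = if does (odd? x) ∨ does (x ≟ N) then x else suc x

roundUp-cases : ∀ N x → roundUp N x ≡ x ⊎ (Even x × x ≢ N × roundUp N x ≡ suc x)
roundUp-cases N x with odd? x
... | yes ox rewrite dec-true (odd? x) ox = inj₁ refl
... | no ¬ox with x ≟ N
...   | yes x≡N rewrite dec-false (odd? x) ¬ox | dec-true (x ≟ N) x≡N = inj₁ refl
...   | no x≢N  rewrite dec-false (odd? x) ¬ox | dec-false (x ≟ N) x≢N =
          inj₂ (¬odd⇒even x ¬ox , x≢N , refl)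

roundUp-≥ : ∀ N x → x ≤ roundUp N x
roundUp-≥ N x with roundUp-cases N x
... | inj₁ e             = ≤-reflexive (sym e)
... | inj₂ (_ , _ , e)   = ≤-trans (n≤1+n x) (≤-reflexive (sym e))

roundUp-≤ : ∀ N x → roundUp N x ≤ suc x
roundUp-≤ N x with roundUp-cases N x
... | inj₁ e           = ≤-trans (≤-reflexive e) (n≤1+n x)
... | inj₂ (_ , _ , e) = ≤-reflexive e

roundUp-mono : ∀ N {x y} → x ≤ y → roundUp N x ≤ roundUp N y
roundUp-mono N {x} {y} x≤y with m≤n⇒m<n∨m≡n x≤y
... | inj₁ x<y = ≤-trans (roundUp-≤ N x) (≤-trans x<y (roundUp-≥ N y))
... | inj₂ refl = ≤-refl

roundUp-strict : ∀ N {x y} → x < y → roundUp N x < roundUp N y ⊎ (Even x × x ≢ N × y ≡ suc x)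
roundUp-strict N {x} {y} x<y with roundUp-cases N x
... | inj₁ e = inj₁ (≤-trans (s≤s (≤-reflexive e)) (≤-trans x<y (roundUp-≥ N y)))
... | inj₂ (ex , x≢N , e) with m≤n⇒m<n∨m≡n x<y
...   | inj₁ 1+x<y = inj₁ (≤-trans (s≤s (≤-reflexive e)) (≤-trans 1+x<y (roundUp-≥ N y)))
...   | inj₂ 1+x≡y = inj₂ (ex , x≢N , sym 1+x≡y)

raise-classify : ∀ N x a n → raise (classify N x a n) x ≡ roundUp N x
raise-classify N x a n with classify N x a n | classification N x a n
... | _ | bottom ox _  rewrite dec-true (odd? x) ox = refl
... | _ | left ox _ _  rewrite dec-true (odd? x) ox = refl
... | _ | right ox _ _ rewrite dec-true (odd? x) ox = refl
... | _ | top ex x≢N   rewrite dec-false (odd? x) (even⇒¬odd x ex) | dec-false (x ≟ N) x≢N = refl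
... | _ | single ex x≡N rewrite dec-false (odd? x) (even⇒¬odd x ex) | dec-true (x ≟ N) x≡N = refl

free : ∀ {r c} → Array ℕ r c → Fin r → ℕ → Fin c → Bool
free T i v j = does ((at T i j ≟ v) ×-dec ¬? (above T i j ≟ₘ just (v ∸ 1)))

freeBefore : ∀ {r c} → Array ℕ r c → Fin r → ℕ → ℕ → ℕ
freeBefore T i v = count (onℕ (free T i v))

free⇒ : ∀ {r c} (T : Array ℕ r c) i j {v} → free T i v j ≡ true → at T i j ≡ v × above T i j ≢ just (v ∸ 1)
free⇒ T i j {v} = dec-true⁻¹ ((at T i j ≟ v) ×-dec ¬? (above T i j ≟ₘ just (v ∸ 1)))

free⇐ : ∀ {r c} (T : Array ℕ r c) i j {v} → at T i j ≡ v → above T i j ≢ just (v ∸ 1) → free T i v j ≡ true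
free⇐ T i j {v} x≡v a≢ = dec-true ((at T i j ≟ v) ×-dec ¬? (above T i j ≟ₘ just (v ∸ 1))) (x≡v , a≢)

freeBefore-suc : ∀ {r c} (T : Array ℕ r c) i j {v} → free T i v j ≡ true
  → freeBefore T i v (suc (toℕ j)) ≡ suc (freeBefore T i v (toℕ j))
freeBefore-suc T i j f = count-true _ (toℕ j) (trans (onℕ-toℕ _ j) f)

countNoAbove≡freeBefore : ∀ {r c} (T : Array ℕ r c) i v → countNoAbove T i v (v ∸ 1) ≡ freeBefore T i v c
countNoAbove≡freeBefore {c = c} T i v =
  length-filter-tabulate _ c id (onℕ (free T i v)) (λ j → sym (onℕ-toℕ (free T i v) j))

odd-count⇒cond1 : ∀ {r c} (T : Array ℕ r c) i v → Odd v → Odd (countNoAbove T i v (v ∸ 1)) → Cond1 T i v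
odd-count⇒cond1 {c = c} T i v ov oc
  with count-pos⇒∃ (onℕ (free T i v)) {c} (subst (0 <_) (countNoAbove≡freeBefore T i v) (odd⇒0< (countNoAbove T i v (v ∸ 1)) oc))
... | k , _ , fk with onℕ-true _ k fk
...   | j , _ , fj = ov , (j , proj₁ (free⇒ T i j fj)) , oc

pieces : ∀ {r c} → ℕ → Array ℕ r c → Array Piece r c
pieces N T = tabulate₂ λ i j → classify N (at T i j) (above T i j) (freeBefore T i (at T i j) (toℕ j))

labels : ∀ {r c} → Array Piece r c → Array ℕ r c → Array ℕ r c
labels P T = tabulate₂ λ i j → raise (at P i j) (at T i j)

entries : ∀ {r c} → Array Piece r c → Array ℕ r c → Array ℕ r c
entries P L = tabulate₂ λ i j → lower (at P i j) (at L i j)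

entries-labels : ∀ {r c} (P : Array Piece r c) T → entries P (labels P T) ≡ T
entries-labels P T = tabulate₂-at _ T λ i j →
  trans (cong (lower (at P i j)) (at-tabulate₂ _ i j)) (lower-raise (at P i j) (at T i j))

DominoLabel : ℕ → ℕ → Set
DominoLabel N ℓ = Odd ℓ × ℓ ≤ N

MonominoLabel : (r N : ℕ) → Fin r → ℕ → Set
MonominoLabel r N i ℓ = toℕ i ≡ r ∸ 1 × ℓ ≡ N × Even N

module Forward {r c t} (T : Array ℕ r c) (ssyt : IsSSYT r c t T) (unmatched : Unmatched t T) where

  N : ℕ
  N = r + t ∸ 1

  P : Array Piece r c
  P = pieces N T

  L : Array ℕ r c
  L = labels P T

  entry≤N : ∀ i j → at T i j ≤ N
  entry≤N i j = suc[m]≤n⇒m≤pred[n] (proj₁ ssyt i j)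

  row-mono : ∀ i {j j'} → toℕ j ≤ toℕ j' → at T i j ≤ at T i j'
  row-mono i {j} {j'} j≤j' with m≤n⇒m<n∨m≡n j≤j'
  ... | inj₁ j<j' = proj₁ (proj₂ ssyt) i j j' j<j'
  ... | inj₂ j≡j' = ≤-reflexive (cong (at T i) (toℕ-injective j≡j'))

  col-strict : ∀ {i i'} j → toℕ i < toℕ i' → at T i j < at T i' j
  col-strict j = proj₂ (proj₂ ssyt) _ _ j

  Classified : Fin r → Fin c → Piece → Set
  Classified i j = Classification N (at T i j) (above T i j) (freeBefore T i (at T i j) (toℕ j))

  classified-as : ∀ i j {p} → at P i j ≡ p → Classified i j p
  classified-as i j P≡p =
    subst (Classified i j) (trans (sym (at-tabulate₂ _ i j)) P≡p) (classification _ _ _ _)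

  classified⇒piece : ∀ i j {p} → Classified i j p → at P i j ≡ p
  classified⇒piece i j cl = trans (at-tabulate₂ _ i j) (classification⇒classify cl)

  label-raise : ∀ i j → at L i j ≡ raise (at P i j) (at T i j)
  label-raise = at-tabulate₂ _

  label-roundUp : ∀ i j → at L i j ≡ roundUp N (at T i j)
  label-roundUp i j =
    trans (label-raise i j)
          (trans (cong (λ p → raise p (at T i j)) (at-tabulate₂ _ i j))
                 (raise-classify N (at T i j) (above T i j) (freeBefore T i (at T i j) (toℕ j))))

  free-count-even : ∀ i v → Odd v → Even (freeBefore T i v c)
  free-count-even i v ov = ¬odd⇒even (freeBefore T i v c) λ o →
    proj₁ (unmatched i v) (odd-count⇒cond1 T i v ov (subst Odd (sym (countNoAbove≡freeBefore T i v)) o))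

  -- The free occurrences of v in a row form an interval, because rows and columns increase.
  free-between : ∀ i v {j₁ j₂ j₃} → toℕ j₁ ≤ toℕ j₂ → toℕ j₂ ≤ toℕ j₃
    → free T i v j₁ ≡ true → free T i v j₃ ≡ true → free T i v j₂ ≡ true
  free-between i v {j₁} {j₂} {j₃} j₁≤j₂ j₂≤j₃ f₁ f₃ = free⇐ T i j₂ x₂≡v a₂≢
    where
      x₃≡v : at T i j₃ ≡ v
      x₃≡v = proj₁ (free⇒ T i j₃ f₃)
      x₂≡v : at T i j₂ ≡ v
      x₂≡v = ≤-antisym (≤-trans (row-mono i j₂≤j₃) (≤-reflexive x₃≡v))
                       (≤-trans (≤-reflexive (sym (proj₁ (free⇒ T i j₁ f₁)))) (row-mono i j₁≤j₂))
      a₂≢ : above T i j₂ ≢ just (v ∸ 1)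
      a₂≢ a₂≡ with above≡just T i j₂ a₂≡
      ... | i' , i'+1≡i , y₂≡ = proj₂ (free⇒ T i j₃ f₃) (trans (above-of T j₃ i'+1≡i) (cong just y₃≡))
        where
          y₃≡ : at T i' j₃ ≡ v ∸ 1
          y₃≡ = ≤-antisym (suc[m]≤n⇒m≤pred[n] (≤-trans (col-strict j₃ (≤-reflexive i'+1≡i)) (≤-reflexive x₃≡v)))
                          (≤-trans (≤-reflexive (sym y₂≡)) (row-mono i' j₂≤j₃))

  free-even⇒hl : ∀ i j {v} → free T i v j ≡ true → Odd v → Even (freeBefore T i v (toℕ j)) → at P i j ≡ hl
  free-even⇒hl i j f ov e with free⇒ T i j f
  ... | refl , a≢ = classified⇒piece i j (left ov a≢ e)

  free-odd⇒hr : ∀ i j {v} → free T i v j ≡ true → Odd v → Odd (freeBefore T i v (toℕ j)) → at P i j ≡ hr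
  free-odd⇒hr i j f ov o with free⇒ T i j f
  ... | refl , a≢ = classified⇒piece i j (right ov a≢ o)

  free-next : ∀ i j {v} → free T i v j ≡ true → Odd v → Even (freeBefore T i v (toℕ j))
    → ∃[ j' ] (toℕ j' ≡ suc (toℕ j) × free T i v j' ≡ true)
  free-next i j {v} f ov even
    with count-differs⇒∃ (onℕ (free T i v)) (toℕ<n j) (λ e →
           even⇒¬odd (freeBefore T i v c) (free-count-even i v ov)
             (subst Odd e (subst Odd (sym (freeBefore-suc T i j f)) (even⇒odd-suc (freeBefore T i v (toℕ j)) even))))
  ... | n , j+1≤n , n<c , fn with onℕ-true _ n fn | successor j (≤-<-trans j+1≤n n<c)
  ...   | j₃ , j₃≡n , f₃ | j' , j'≡j+1 =
          j' , j'≡j+1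
        , free-between i v (≤-trans (n≤1+n _) (≤-reflexive (sym j'≡j+1)))
                           (subst₂ _≤_ (sym j'≡j+1) (sym j₃≡n) j+1≤n) f f₃

  free-prev : ∀ i j {v} → free T i v j ≡ true → Odd (freeBefore T i v (toℕ j))
    → ∃[ j' ] (suc (toℕ j') ≡ toℕ j × free T i v j' ≡ true)
  free-prev i j {v} f odd with count-pos⇒∃ (onℕ (free T i v)) (odd⇒0< (freeBefore T i v (toℕ j)) odd)
  ... | n , n<j , fn with onℕ-true _ n fn | predecessor j (≤-<-trans z≤n n<j)
  ...   | j₀ , j₀≡n , f₀ | j' , j'+1≡j =
          j' , j'+1≡j
        , free-between i v (s≤s⁻¹ (subst₂ _<_ (sym j₀≡n) (sym j'+1≡j) n<j))
                           (≤-trans (n≤1+n _) (≤-reflexive j'+1≡j)) f₀ f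

  hl-right : ∀ i j → at P i j ≡ hl → ∃[ j' ] (toℕ j' ≡ suc (toℕ j) × at P i j' ≡ hr × at T i j' ≡ at T i j)
  hl-right i j hl-ij = partner (classified-as i j hl-ij)
    where
      partner : Classified i j hl → ∃[ j' ] (toℕ j' ≡ suc (toℕ j) × at P i j' ≡ hr × at T i j' ≡ at T i j)
      partner (left ox a≢ even) =
        let f = free⇐ T i j {at T i j} refl a≢
            (j' , j'≡j+1 , f') = free-next i j f ox even
            odd-next = subst Odd (sym (freeBefore-suc T i j f)) (even⇒odd-suc (freeBefore T i (at T i j) (toℕ j)) even)
        in j' , j'≡j+1
         , free-odd⇒hr i j' f' ox (subst (λ k → Odd (freeBefore T i (at T i j) k)) (sym j'≡j+1) odd-next)
         , proj₁ (free⇒ T i j' f')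

  hr-left : ∀ i j → at P i j ≡ hr → ∃[ j' ] (suc (toℕ j') ≡ toℕ j × at P i j' ≡ hl × at T i j' ≡ at T i j)
  hr-left i j hr-ij = partner (classified-as i j hr-ij)
    where
      partner : Classified i j hr → ∃[ j' ] (suc (toℕ j') ≡ toℕ j × at P i j' ≡ hl × at T i j' ≡ at T i j)
      partner (right ox a≢ odd) =
        let (j' , j'+1≡j , f') = free-prev i j (free⇐ T i j {at T i j} refl a≢) odd
            count≡ = trans (cong (freeBefore T i (at T i j)) (sym j'+1≡j)) (freeBefore-suc T i j' f')
        in j' , j'+1≡j
         , free-even⇒hl i j' f' ox (odd-suc⇒even (freeBefore T i (at T i j) (toℕ j')) (subst Odd count≡ odd))
         , proj₁ (free⇒ T i j' f')

  successor-below : ∀ i j → Even (at T i j) → at T i j ≢ N → below T i j ≡ just (suc (at T i j))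
  successor-below i j ex x≢N with below T i j ≟ₘ just (suc (at T i j)) | rightmost (λ j' → at T i j' ≟ at T i j) j refl
  ... | yes b | _ = b
  ... | no ¬b | j* , j≤j* , x*≡x , beyond = ⊥-elim (matched (even⊎odd (countNoAbove T i (suc x) x)))
    where
      x = at T i j
      ¬b* : ¬ (below T i j* ≡ just (suc x))
      ¬b* b* with below≡just T i j* b*
      ... | i' , i'≡i+1 , y*≡ =
        ¬b (trans (below-of T j i'≡i+1)
                  (cong just (≤-antisym (≤-trans (row-mono i' j≤j*) (≤-reflexive y*≡))
                                        (col-strict j (≤-reflexive (sym i'≡i+1))))))
      matched : Even (countNoAbove T i (suc x) x) ⊎ Odd (countNoAbove T i (suc x) x) → ⊥
      matched (inj₁ e) = proj₂ (unmatched i x) (ex , ≤∧≢⇒< (entry≤N i j) x≢N , (j* , x*≡x , beyond , ¬b*) , e)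
      matched (inj₂ o) = proj₁ (unmatched i (suc x)) (odd-count⇒cond1 T i (suc x) (even⇒odd-suc x ex) o)

  vt-below : ∀ i j → at P i j ≡ vt → ∃[ i' ] (toℕ i' ≡ suc (toℕ i) × at P i' j ≡ vb × at T i' j ≡ suc (at T i j))
  vt-below i j vt-ij = partner (classified-as i j vt-ij)
    where
      partner : Classified i j vt → ∃[ i' ] (toℕ i' ≡ suc (toℕ i) × at P i' j ≡ vb × at T i' j ≡ suc (at T i j))
      partner (top ex x≢N) =
        let (i' , i'≡i+1 , y≡) = below≡just T i j (successor-below i j ex x≢N)
            oy = subst Odd (sym y≡) (even⇒odd-suc (at T i j) ex)
            a≡ = trans (above-of T j (sym i'≡i+1)) (cong (λ y → just (y ∸ 1)) (sym y≡))
        in i' , i'≡i+1 , classified⇒piece i' j (bottom oy a≡) , y≡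

  vb-above : ∀ i j → at P i j ≡ vb → ∃[ i' ] (suc (toℕ i') ≡ toℕ i × at P i' j ≡ vt)
  vb-above i j vb-ij = partner (classified-as i j vb-ij)
    where
      partner : Classified i j vb → ∃[ i' ] (suc (toℕ i') ≡ toℕ i × at P i' j ≡ vt)
      partner (bottom ox a≡) =
        let (i' , i'+1≡i , y≡) = above≡just T i j a≡
            ey = subst Even (sym y≡) (odd⇒even-pred (at T i j) ox)
            y≢N = <⇒≢ (≤-trans (col-strict j (≤-reflexive i'+1≡i)) (entry≤N i j))
        in i' , i'+1≡i , classified⇒piece i' j (top ey y≢N)

  tiling : IsTiling P
  tiling = (λ i j e → let (j' , p , q , _) = hl-right i j e in j' , p , q)
         , (λ i j e → let (j' , p , q , _) = hr-left i j e in j' , p , q)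
         , (λ i j e → let (i' , p , q , _) = vt-below i j e in i' , p , q)
         , vb-above

  same-row-label : ∀ i j j' → SameTileRow P i j j' → at L i j ≡ at L i j'
  same-row-label i j j' (hl-ij , j'≡j+1) =
    let (j'' , j''≡j+1 , _ , x''≡x) = hl-right i j hl-ij
        x'≡x = subst (λ k → at T i k ≡ at T i j) (toℕ-injective (trans j''≡j+1 (sym j'≡j+1))) x''≡x
    in trans (label-roundUp i j) (trans (cong (roundUp N) (sym x'≡x)) (sym (label-roundUp i j')))

  same-col-label : ∀ i i' j → SameTileCol P i i' j → at L i j ≡ at L i' j
  same-col-label i i' j (vt-ij , i'≡i+1) =
    let (i'' , i''≡i+1 , vb'' , y≡) = vt-below i j vt-ij
        i''≡i' = toℕ-injective (trans i''≡i+1 (sym i'≡i+1))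
    in begin
    at L i j                        ≡⟨ label-raise i j ⟩
    raise (at P i j) (at T i j)     ≡⟨ cong (λ p → raise p (at T i j)) vt-ij ⟩
    suc (at T i j)                  ≡⟨ y≡ ⟨
    at T i'' j                      ≡⟨ cong (λ p → raise p (at T i'' j)) vb'' ⟨
    raise (at P i'' j) (at T i'' j) ≡⟨ label-raise i'' j ⟨
    at L i'' j                      ≡⟨ cong (λ k → at L k j) i''≡i' ⟩
    at L i' j                       ∎
    where open ≡-Reasoning

  domino-label : ∀ i j → at P i j ≢ mono → DominoLabel N (at L i j)
  domino-label i j ≢mono rewrite label-raise i j with at P i j | classified-as i j refl
  ... | vb   | bottom ox _  = ox , entry≤N i j
  ... | hl   | left ox _ _  = ox , entry≤N i j
  ... | hr   | right ox _ _ = ox , entry≤N i j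
  ... | vt   | top ex x≢N   = even⇒odd-suc (at T i j) ex , ≤∧≢⇒< (entry≤N i j) x≢N
  ... | mono | single _ _   = ⊥-elim (≢mono refl)

  monomino-label : ∀ i j → at P i j ≡ mono → MonominoLabel r N i (at L i j)
  monomino-label i j mono-ij = label (classified-as i j mono-ij)
    where
      last-row : at T i j ≡ N → toℕ i ≡ r ∸ 1
      last-row x≡N with suc (toℕ i) <? r
      ... | no i+1≮r = cong (_∸ 1) (≤-antisym (toℕ<n i) (≮⇒≥ i+1≮r))
      ... | yes i+1<r =
        let (i' , i'≡i+1) = successor i i+1<r
        in ⊥-elim (<⇒≱ (col-strict j (≤-reflexive (sym i'≡i+1))) (≤-trans (entry≤N i' j) (≤-reflexive (sym x≡N))))
      label : Classified i j mono → MonominoLabel r N i (at L i j)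
      label (single ex x≡N) =
          last-row x≡N
        , trans (label-raise i j) (trans (cong (λ p → raise p (at T i j)) mono-ij) x≡N)
        , subst Even x≡N ex

  row-label : ∀ i j j' → toℕ j < toℕ j' → ¬ SameTileRow P i j j' → at L i j ≤ at L i j'
  row-label i j j' j<j' _ =
    subst₂ _≤_ (sym (label-roundUp i j)) (sym (label-roundUp i j')) (roundUp-mono N (row-mono i (<⇒≤ j<j')))

  col-label : ∀ i i' j → toℕ i < toℕ i' → ¬ SameTileCol P i i' j → at L i j < at L i' j
  col-label i i' j i<i' ¬same with roundUp-strict N (col-strict j i<i')
  ... | inj₁ lt = subst₂ _<_ (sym (label-roundUp i j)) (sym (label-roundUp i' j)) lt
  ... | inj₂ (ex , x≢N , y≡x+1) = ⊥-elim (¬same (vt-ij , adjacent))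
    where
      vt-ij : at P i j ≡ vt
      vt-ij = classified⇒piece i j (top ex x≢N)
      adjacent : toℕ i' ≡ suc (toℕ i)
      adjacent with m≤n⇒m<n∨m≡n i<i'
      ... | inj₂ i+1≡i' = sym i+1≡i'
      ... | inj₁ i+1<i' =
        let (i'' , i''≡i+1 , _ , y''≡x+1) = vt-below i j vt-ij
        in ⊥-elim (<-irrefl (trans y''≡x+1 (sym y≡x+1)) (col-strict j (subst (_< toℕ i') (sym i''≡i+1) i+1<i')))

  ssdt : IsSSDT r c (DominoLabel N) (MonominoLabel r N) (P , L)
  ssdt = tiling , same-row-label , same-col-label , domino-label , monomino-label , row-label , col-label

module Backward {r c t} (0<r : 0 < r) (P : Array Piece r c) (L : Array ℕ r c)
  (ssdt : IsSSDT r c (DominoLabel (r + t ∸ 1)) (MonominoLabel r (r + t ∸ 1)) (P , L)) where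

  N : ℕ
  N = r + t ∸ 1

  X : Array ℕ r c
  X = entries P L

  tiling : IsTiling P
  tiling = proj₁ ssdt

  same-row-label : ∀ i j j' → SameTileRow P i j j' → at L i j ≡ at L i j'
  same-row-label = proj₁ (proj₂ ssdt)

  same-col-label : ∀ i i' j → SameTileCol P i i' j → at L i j ≡ at L i' j
  same-col-label = proj₁ (proj₂ (proj₂ ssdt))

  domino-label : ∀ i j → at P i j ≢ mono → DominoLabel N (at L i j)
  domino-label = proj₁ (proj₂ (proj₂ (proj₂ ssdt)))

  monomino-label : ∀ i j → at P i j ≡ mono → MonominoLabel r N i (at L i j)
  monomino-label = proj₁ (proj₂ (proj₂ (proj₂ (proj₂ ssdt))))

  row-label : ∀ i j j' → toℕ j < toℕ j' → ¬ SameTileRow P i j j' → at L i j ≤ at L i j'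
  row-label = proj₁ (proj₂ (proj₂ (proj₂ (proj₂ (proj₂ ssdt)))))

  col-label : ∀ i i' j → toℕ i < toℕ i' → ¬ SameTileCol P i i' j → at L i j < at L i' j
  col-label = proj₂ (proj₂ (proj₂ (proj₂ (proj₂ (proj₂ ssdt)))))

  entry-as : ∀ i j {p} → at P i j ≡ p → at X i j ≡ lower p (at L i j)
  entry-as i j P≡p = trans (at-tabulate₂ _ i j) (cong (λ p → lower p (at L i j)) P≡p)

  entry-≢vt : ∀ i j → at P i j ≢ vt → at X i j ≡ at L i j
  entry-≢vt i j P≢vt = trans (entry-as i j refl) (lower-≢vt (at P i j) (at L i j) P≢vt)

  entry≤label : ∀ i j → at X i j ≤ at L i j
  entry≤label i j = ≤-trans (≤-reflexive (entry-as i j refl)) (lower-≤ (at P i j) (at L i j))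

  label-odd : ∀ i j {p} → at P i j ≡ p → p ≢ mono → Odd (at L i j)
  label-odd i j P≡p p≢mono = proj₁ (domino-label i j λ P≡mono → p≢mono (trans (sym P≡p) P≡mono))

  label≤N : ∀ i j → at L i j ≤ N
  label≤N i j with at P i j ≟ₚ mono
  ... | yes P≡mono = ≤-reflexive (proj₁ (proj₂ (monomino-label i j P≡mono)))
  ... | no  P≢mono = proj₂ (domino-label i j P≢mono)

  not-last⇒≢mono : ∀ {i i' : Fin r} j → toℕ i < toℕ i' → at P i j ≢ mono
  not-last⇒≢mono {i} {i'} j i<i' P≡mono =
    <⇒≱ i<i' (≤-trans (<⇒≤pred (toℕ<n i')) (≤-reflexive (sym (proj₁ (monomino-label i j P≡mono)))))

  vt-below : ∀ i j → at P i j ≡ vt → ∃[ i' ] (toℕ i' ≡ suc (toℕ i) × at P i' j ≡ vb × at L i' j ≡ at L i j)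
  vt-below i j vt-ij with proj₁ (proj₂ (proj₂ tiling)) i j vt-ij
  ... | i' , i'≡i+1 , vb' = i' , i'≡i+1 , vb' , sym (same-col-label i i' j (vt-ij , i'≡i+1))

  vb-above : ∀ i j → at P i j ≡ vb → ∃[ i' ] (suc (toℕ i') ≡ toℕ i × at P i' j ≡ vt × at L i' j ≡ at L i j)
  vb-above i j vb-ij with proj₂ (proj₂ (proj₂ tiling)) i j vb-ij
  ... | i' , i'+1≡i , vt' = i' , i'+1≡i , vt' , same-col-label i' i j (vt' , sym i'+1≡i)

  hl-right : ∀ i j → at P i j ≡ hl → ∃[ j' ] (toℕ j' ≡ suc (toℕ j) × at P i j' ≡ hr × at L i j' ≡ at L i j)
  hl-right i j hl-ij with proj₁ tiling i j hl-ij
  ... | j' , j'≡j+1 , hr' = j' , j'≡j+1 , hr' , sym (same-row-label i j j' (hl-ij , j'≡j+1))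

  hr-left : ∀ i j → at P i j ≡ hr → ∃[ j' ] (suc (toℕ j') ≡ toℕ j × at P i j' ≡ hl × at L i j' ≡ at L i j)
  hr-left i j hr-ij with proj₁ (proj₂ tiling) i j hr-ij
  ... | j' , j'+1≡j , hl' = j' , j'+1≡j , hl' , same-row-label i j' j (hl' , sym j'+1≡j)

  -- Both labels are odd: the upper cell is not in the last row, so it is not a monomino.
  col-gap : ∀ {i i' : Fin r} j {p} → toℕ i < toℕ i' → ¬ SameTileCol P i i' j → at P i' j ≡ p → p ≢ mono
    → 2 + at L i j ≤ at L i' j
  col-gap {i} {i'} j i<i' ¬same P≡p p≢mono =
    odd<odd⇒2+≤ (label-odd i j refl (not-last⇒≢mono j i<i')) (label-odd i' j P≡p p≢mono) (col-label i i' j i<i' ¬same)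

  free-above : ∀ i j {p} → at P i j ≡ p → p ≢ vb → p ≢ mono → above X i j ≢ just (at L i j ∸ 1)
  free-above i j P≡p p≢vb p≢mono a≡ with above≡just X i j a≡
  ... | i' , i'+1≡i , w≡ = <-irrefl w≡ w<
    where
      ¬same : ¬ SameTileCol P i' i j
      ¬same (vt' , i≡i'+1) with vt-below i' j vt'
      ... | i'' , i''≡i'+1 , vb'' , _ with toℕ-injective (trans i''≡i'+1 (sym i≡i'+1))
      ...   | refl = p≢vb (trans (sym P≡p) vb'')
      w< : at X i' j < at L i j ∸ 1
      w< = ≤-<-trans (entry≤label i' j)
             (suc[m]≤n⇒m≤pred[n] (col-gap j (≤-reflexive i'+1≡i) ¬same P≡p p≢mono))

  free-horizontal : ∀ i j {p v} → at P i j ≡ p → p ≢ vb → p ≢ mono → at X i j ≡ at L i j → at L i j ≡ v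
    → free X i v j ≡ true
  free-horizontal i j P≡p p≢vb p≢mono X≡L L≡v =
    free⇐ X i j (trans X≡L L≡v) (subst (λ ℓ → above X i j ≢ just (ℓ ∸ 1)) L≡v (free-above i j P≡p p≢vb p≢mono))

  label-row-mono : ∀ i {j j'} → toℕ j < toℕ j' → at L i j ≤ at L i j'
  label-row-mono i {j} {j'} j<j' with sameTileRow? P i j j'
  ... | yes same = ≤-reflexive (same-row-label i j j' same)
  ... | no ¬same = row-label i j j' j<j' ¬same

  entries-row : ∀ i j j' → toℕ j < toℕ j' → at X i j ≤ at X i j'
  entries-row i j j' j<j' with at P i j' ≟ₚ vt
  ... | no P'≢vt = ≤-trans (entry≤label i j) (≤-trans (label-row-mono i j<j') (≤-reflexive (sym (entry-≢vt i j' P'≢vt))))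
  ... | yes vt' with at P i j ≟ₚ vt
  ...   | yes vt-ij = subst₂ _≤_ (sym (entry-as i j vt-ij)) (sym (entry-as i j' vt')) (∸-monoˡ-≤ 1 (label-row-mono i j<j'))
  -- at L i j < at L i'' j ≤ at L i'' j' = at L i j', with i'' the row below i
  ...   | no P≢vt with vt-below i j' vt'
  ...     | i'' , i''≡i+1 , _ , L''≡ =
          subst₂ _≤_ (sym (entry-≢vt i j P≢vt)) (sym (entry-as i j' vt'))
            (suc[m]≤n⇒m≤pred[n] (<-≤-trans (col-label i i'' j (≤-reflexive (sym i''≡i+1)) λ (vt-ij , _) → P≢vt vt-ij)
                                            (≤-trans (label-row-mono i'' j<j') (≤-reflexive L''≡))))

  entries-col : ∀ i i' j → toℕ i < toℕ i' → at X i j < at X i' j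
  entries-col i i' j i<i' with sameTileCol? P i i' j
  ... | yes (vt-ij , i'≡i+1) with vt-below i j vt-ij
  ...   | i'' , i''≡i+1 , vb'' , L''≡ with toℕ-injective (trans i''≡i+1 (sym i'≡i+1))
  ...     | refl = subst₂ _<_ (sym (entry-as i j vt-ij)) (sym (trans (entry-as i'' j vb'') L''≡))
                     (pred< (odd⇒0< (at L i j) (label-odd i j vt-ij λ ())))
  entries-col i i' j i<i' | no ¬same with at P i' j ≟ₚ vt
  ... | no P'≢vt = ≤-<-trans (entry≤label i j)
                     (≤-trans (col-label i i' j i<i' ¬same) (≤-reflexive (sym (entry-≢vt i' j P'≢vt))))
  ... | yes vt' = ≤-<-trans (entry≤label i j)
                    (subst (at L i j <_) (sym (entry-as i' j vt')) (suc[m]≤n⇒m≤pred[n] (col-gap j i<i' ¬same vt' λ ())))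

  entries-ssyt : IsSSYT r c t X
  entries-ssyt =
      (λ i j → ≤-<-trans (entry≤label i j) (≤-<-trans (label≤N i j) (pred< (≤-trans 0<r (m≤m+n r t)))))
    , entries-row
    , entries-col

  paired : ∀ R v → Odd v → ∀ j → free X R v j ≡ true
    → (at P R j ≡ hl × ∃[ j' ] (toℕ j' ≡ suc (toℕ j) × free X R v j' ≡ true × at P R j' ≡ hr))
    ⊎ (at P R j ≡ hr × ∃[ j' ] (suc (toℕ j') ≡ toℕ j × free X R v j' ≡ true × at P R j' ≡ hl))
  paired R v ov j f with free⇒ X R j f | at P R j in P≡
  ... | x≡v , _ | hl with hl-right R j P≡
  ...   | j' , j'≡j+1 , hr' , L'≡ =
          inj₁ (refl , j' , j'≡j+1 , free-horizontal R j' hr' (λ ()) (λ ()) (entry-as R j' hr') (trans L'≡ L≡v) , hr')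
    where L≡v = trans (sym (entry-as R j P≡)) x≡v
  paired R v ov j f | x≡v , _ | hr with hr-left R j P≡
  ...   | j' , j'+1≡j , hl' , L'≡ =
          inj₂ (refl , j' , j'+1≡j , free-horizontal R j' hl' (λ ()) (λ ()) (entry-as R j' hl') (trans L'≡ L≡v) , hl')
    where L≡v = trans (sym (entry-as R j P≡)) x≡v
  paired R v ov j f | x≡v , _ | vt =
    ⊥-elim (even⇒¬odd v (subst Even (trans (sym (entry-as R j P≡)) x≡v) (odd⇒even-pred (at L R j) (label-odd R j P≡ λ ()))) ov)
  paired R v ov j f | x≡v , a≢ | vb with vb-above R j P≡
  ...   | i' , i'+1≡R , vt' , L'≡ =
          ⊥-elim (a≢ (trans (above-of X j i'+1≡R)
                       (cong just (trans (entry-as i' j vt') (cong (_∸ 1) (trans L'≡ (trans (sym (entry-as R j P≡)) x≡v)))))))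
  paired R v ov j f | x≡v , _ | mono =
    ⊥-elim (even⇒¬odd v (subst Even (trans N≡L (trans (sym (entry-as R j P≡)) x≡v)) (proj₂ (proj₂ (monomino-label R j P≡)))) ov)
    where N≡L = sym (proj₁ (proj₂ (monomino-label R j P≡)))

  module Row (R : Fin r) (v : ℕ) (ov : Odd v) = DominoRow (free X R v) (at P R) (paired R v ov)

  entries-unmatched : Unmatched t X
  entries-unmatched R v = ¬cond1 , ¬cond2
    where
      ¬cond1 : ¬ Cond1 X R v
      ¬cond1 (ov , _ , oc) =
        even⇒¬odd (countNoAbove X R v (v ∸ 1)) (subst Even (sym (countNoAbove≡freeBefore X R v)) (Row.even-count R v ov)) oc
      ¬cond2 : ¬ Cond2 t X R v
      ¬cond2 (ev , v<N , (j , x≡v , _ , ¬b) , _) with at P R j ≟ₚ vt | at P R j ≟ₚ mono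
      ... | yes vt-Rj | _ with vt-below R j vt-Rj
      ...   | i' , i'≡R+1 , vb' , L'≡ = ¬b (trans (below-of X j i'≡R+1) (cong just X'≡v+1))
        where
          X'≡v+1 : at X i' j ≡ suc v
          X'≡v+1 = begin
            at X i' j              ≡⟨ entry-as i' j vb' ⟩
            at L i' j              ≡⟨ L'≡ ⟩
            at L R j               ≡⟨ odd⇒suc-pred (at L R j) (label-odd R j vt-Rj λ ()) ⟨
            suc (at L R j ∸ 1)     ≡⟨ cong suc (trans (sym (entry-as R j vt-Rj)) x≡v) ⟩
            suc v                  ∎
            where open ≡-Reasoning
      ¬cond2 (ev , v<N , (j , x≡v , _ , _) , _) | no _ | yes mono-Rj =
        <-irrefl (trans (sym x≡v) (trans (entry-as R j mono-Rj) (proj₁ (proj₂ (monomino-label R j mono-Rj))))) v<N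
      ¬cond2 (ev , v<N , (j , x≡v , _ , _) , _) | no P≢vt | no P≢mono =
        even⇒¬odd v ev (subst Odd (trans (sym (entry-≢vt R j P≢vt)) x≡v) (proj₁ (domino-label R j P≢mono)))

  ClassifiedEntry : Fin r → Fin c → Piece → Set
  ClassifiedEntry i j = Classification N (at X i j) (above X i j) (freeBefore X i (at X i j) (toℕ j))

  classify-entry : ∀ i j {p} → ClassifiedEntry i j p
    → classify N (at X i j) (above X i j) (freeBefore X i (at X i j) (toℕ j)) ≡ p
  classify-entry i j = classification⇒classify

  pieces-entries : pieces N X ≡ P
  pieces-entries = tabulate₂-at _ P piece
    where
      piece : ∀ i j → classify N (at X i j) (above X i j) (freeBefore X i (at X i j) (toℕ j)) ≡ at P i j
      piece i j with at P i j in P≡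
      ... | hl = classify-entry i j (left ox a≢ (Row.even-count-before-hl i (at X i j) ox j f P≡))
        where
          ox = subst Odd (sym (entry-as i j P≡)) (label-odd i j P≡ λ ())
          a≢ = subst (λ x → above X i j ≢ just (x ∸ 1)) (sym (entry-as i j P≡)) (free-above i j P≡ (λ ()) (λ ()))
          f = free⇐ X i j refl a≢
      ... | hr = classify-entry i j (right ox a≢ (Row.odd-count-before-hr i (at X i j) ox j f P≡))
        where
          ox = subst Odd (sym (entry-as i j P≡)) (label-odd i j P≡ λ ())
          a≢ = subst (λ x → above X i j ≢ just (x ∸ 1)) (sym (entry-as i j P≡)) (free-above i j P≡ (λ ()) (λ ()))
          f = free⇐ X i j refl a≢
      ... | vt = classify-entry i j (top ex x≢N)
        where
          odd-L = label-odd i j P≡ λ ()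
          ex = subst Even (sym (entry-as i j P≡)) (odd⇒even-pred (at L i j) odd-L)
          x≢N = <⇒≢ (subst (_< N) (sym (entry-as i j P≡)) (<-≤-trans (pred< (odd⇒0< (at L i j) odd-L)) (label≤N i j)))
      ... | vb with vb-above i j P≡
      ...   | i' , i'+1≡i , vt' , L'≡ = classify-entry i j (bottom ox a≡)
        where
          ox = subst Odd (sym (entry-as i j P≡)) (label-odd i j P≡ λ ())
          a≡ = trans (above-of X j i'+1≡i)
                     (cong just (trans (entry-as i' j vt') (cong (_∸ 1) (trans L'≡ (sym (entry-as i j P≡))))))
      piece i j | mono = classify-entry i j (single (subst Even (sym x≡N) (proj₂ (proj₂ (monomino-label i j P≡)))) x≡N)
        where
          x≡N = trans (entry-as i j P≡) (proj₁ (proj₂ (monomino-label i j P≡)))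

  labels-entries : labels (pieces N X) X ≡ L
  labels-entries rewrite pieces-entries = tabulate₂-at _ L λ i j →
    trans (cong (raise (at P i j)) (entry-as i j refl)) (raise-lower (at P i j) (at L i j) λ vt-ij → label-odd i j vt-ij λ ())

IsSSDT-map : ∀ {r c} {D D' : ℕ → Set} {M M' : Fin r → ℕ → Set}
  → (∀ ℓ → D ℓ → D' ℓ) → (∀ i ℓ → M i ℓ → M' i ℓ) → ∀ b → IsSSDT r c D M b → IsSSDT r c D' M' b
IsSSDT-map D⇒D' M⇒M' _ (tiling , row-tile , col-tile , domino , monomino , rows , cols) =
  tiling , row-tile , col-tile , (λ i j ≢mono → D⇒D' _ (domino i j ≢mono)) , (λ i j ≡mono → M⇒M' i _ (monomino i j ≡mono))
  , rows , cols

unmatched-bijection : ∀ {r c t} (D : ℕ → Set) (M : Fin r → ℕ → Set) → 0 < r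
  → (∀ ℓ → D ℓ ⇔ DominoLabel (r + t ∸ 1) ℓ) → (∀ i ℓ → M i ℓ ⇔ MonominoLabel r (r + t ∸ 1) i ℓ)
  → SubsetBijection (UnmatchedSSYT r c t) (IsSSDT r c D M)
unmatched-bijection {r} {c} {t} D M 0<r D⇔ M⇔ = record
  { to      = λ T _ → pieces N T , labels (pieces N T) T
  ; to-ok   = λ T (ssyt , unmatched) →
      IsSSDT-map (λ ℓ → Equivalence.from (D⇔ ℓ)) (λ i ℓ → Equivalence.from (M⇔ i ℓ))
        (pieces N T , labels (pieces N T) T) (Forward.ssdt T ssyt unmatched)
  ; from    = λ (P , L) _ → entries P L
  ; from-ok = λ (P , L) q → let open Backward 0<r P L (canonical (P , L) q) in entries-ssyt , entries-unmatched
  ; from-to = λ T _ → entries-labels (pieces N T) T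
  ; to-from = λ (P , L) q → let open Backward 0<r P L (canonical (P , L) q) in cong₂ _,_ pieces-entries labels-entries
  }
  where
    N : ℕ
    N = r + t ∸ 1
    canonical : ∀ b → IsSSDT r c D M b → IsSSDT r c (DominoLabel N) (MonominoLabel r N) b
    canonical = IsSSDT-map (λ ℓ → Equivalence.to (D⇔ ℓ)) (λ i ℓ → Equivalence.to (M⇔ i ℓ))

proposition5p7 : (r c t : ℕ) → 0 < r → 0 < c → 0 < t
    → ((r + t ∸ 1) % 2 ≡ 1
        → SubsetBijection (UnmatchedSSYT r c t)
            (IsSSDT r c (λ ℓ → ℓ % 2 ≡ 1 × ℓ ≤ r + t ∸ 1) NoMono))
    × ((r + t ∸ 1) % 2 ≡ 0
        → SubsetBijection (UnmatchedSSYT r c t)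
            (IsSSDT r c (λ ℓ → ℓ % 2 ≡ 1 × ℓ ≤ r + t ∸ 2)
              (λ i ℓ → toℕ i ≡ r ∸ 1 × ℓ ≡ r + t ∸ 1)))
proposition5p7 r c t 0<r _ _ =
    (λ odd-N → unmatched-bijection _ _ 0<r (λ _ → mk⇔ id id)
                 (λ _ _ → mk⇔ (λ ()) λ (_ , _ , even-N) → even⇒¬odd N even-N odd-N))
  , (λ even-N → unmatched-bijection _ _ 0<r (odd-label-bound even-N)
                  (λ _ _ → mk⇔ (λ (last , ℓ≡N) → last , ℓ≡N , even-N) λ (last , ℓ≡N , _) → last , ℓ≡N))
  where
    N : ℕ
    N = r + t ∸ 1
    odd-label-bound : Even N → ∀ ℓ → (Odd ℓ × ℓ ≤ r + t ∸ 2) ⇔ DominoLabel N ℓ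
    odd-label-bound even-N ℓ = mk⇔
      (λ (odd-ℓ , ℓ≤) → odd-ℓ , ≤-trans ℓ≤ (∸-monoʳ-≤ (r + t) (s≤s z≤n)))
      (λ (odd-ℓ , ℓ≤N) → odd-ℓ , ≤-trans (<⇒≤pred (≤∧≢⇒< ℓ≤N λ { refl → even⇒¬odd N even-N odd-ℓ }))
                                          (≤-reflexive (∸-+-assoc (r + t) 1 1)))
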